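{- A positive integer $n$ is an almost-square if and only if $n=k(k+h)$ for some integers $k\ge1$ and $h$ with $0\le h\le T(k)$.
   Context: For a positive integer $n$, let $s(n)=\min_{d\mid n}(d+n/d)$ and $F(n)=n/s(n)$. A positive integer $n$ is an almost-square if $F(k)\le F(n)$ for all positive integers $k\le n$. The triangular numbers are $t_j=\binom{j}{2}=j(j-1)/2$ for integers $j\ge1$ (so $t_1=0$, $t_2=1$, $t_3=3,\dots$), and for real $x$, $T(x)$ denotes the number of indices $j\ge1$ with $t_j\le x$ (so, e.g., $T(1)=2$). -}

module Defs where

open import Data.Nat using (ℕ; zero; suc; _+_; _*_; _∸_; _≤_; _≤?_; _⊓_; NonZero)
open import Data.Nat.DivMod using (_/_)
open import Data.Nat.Divisibility using (_∣_; _∣?_)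
open import Data.List using (List; []; _∷_; foldr; map; filter; applyUpTo; length)
open import Data.Integer using (+_)
open import Data.Rational using (ℚ)
import Data.Rational as ℚ

divisorIdx : ℕ → List ℕ
divisorIdx n = filter (λ i → suc i ∣? n) (applyUpTo (λ i → i) n)

-- s(n) = min over divisors d of n of d + n/d.
-- (The fold starts at 1 + n, which is the value for d = 1, so for n ≥ 1 it
-- does not affect the minimum.)
s : ℕ → ℕ
s n = foldr _⊓_ (suc n) (map (λ i → suc i + n / suc i) (divisorIdx n))

private
  minSucs : (b : ℕ) (f : ℕ → ℕ) (xs : List ℕ) → NonZero (foldr _⊓_ (suc b) (map (λ i → suc (f i)) xs))
  minSucs b f [] = _
  minSucs b f (x ∷ xs) with foldr _⊓_ (suc b) (map (λ i → suc (f i)) xs) | minSucs b f xs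
  ... | suc m | _ = _

s-nonZero : ∀ n → NonZero (s n)
s-nonZero n = minSucs n (λ i → i + n / suc i) (divisorIdx n)

F : ℕ → ℚ
F n = ℚ._/_ (+ n) (s n) {{s-nonZero n}}

AlmostSquare : ℕ → Set
AlmostSquare n = ∀ k → 1 ≤ k → k ≤ n → F k ℚ.≤ F n

t : ℕ → ℕ
t j = (j * (j ∸ 1)) / 2

-- T(x) for natural x: number of j ≥ 1 with t_j ≤ x. Since t_j ≥ j - 1,
-- any such j satisfies j ≤ x + 1, so it suffices to count j ∈ {1,…,x+1}.
T : ℕ → ℕ
T x = length (filter (λ j → t j ≤? x) (applyUpTo suc (suc x)))

{-# OPTIONS --safe #-}
-- For n = k(k + h) put σ = 2k + h, so s(n) ≤ σ, with equality for a suitable such factorisation.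
-- Since σ² = 4n + h² and h² = h + 2 t_h, the condition t_h ≤ k (equivalently h ≤ T(k)) says
-- exactly σ(σ - 1) ≤ 4n.
-- If it holds and m = ab ≤ n with s(m) = a + b, then either a + b ≥ σ, or
-- 4mσ ≤ (a + b)²σ ≤ (a + b)(σ - 1)σ ≤ 4n(a + b); either way F(m) = m/(a + b) ≤ n/σ ≤ F(n).
-- Conversely, if σ = s(n) has σ(σ - 1) > 4n, let τ be least with 4n < τ(τ + 1), so τ < σ, and
-- split τ or τ - 1 as c + d with |c - d| ≤ 1, taking τ when then cd ≤ n.  A computation by parity
-- gives cd/(c + d) > n/(τ + 1), so F(cd) ≥ cd/(c + d) > n/σ = F(n).
module Submission where

open import Defs
open import Data.Nat using (ℕ; _+_; _*_; _≤_)
open import Data.Product using (Σ; _×_)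
open import Function.Bundles using (_⇔_)
open import Relation.Binary.PropositionalEquality using (_≡_)

open import Data.Nat
  using (zero; suc; _<_; _⊓_; _≤′_; ≤′-refl; ≤′-step; _≤?_; _<?_; z≤n; s≤s; NonZero; >-nonZero⁻¹)
open import Data.Nat.Properties
open import Data.Nat.DivMod using (_/_; /-congˡ; m*n/n≡m; m*[n/m]≡n; +-distrib-/-∣ʳ)
open import Data.Nat.Divisibility using (_∣_; _∣?_; divides-refl; m∣m*n)
open import Data.Nat.Tactic.RingSolver using (solve-∀)
open import Data.List using (foldr; map; filter; applyUpTo; length; [_]; _++_)
open import Data.List.Properties
  using (applyUpTo-∷ʳ; filter-++; length-++; filter-accept; filter-reject; length-filter;
         length-applyUpTo; foldr-preservesᵒ)
open import Data.List.Membership.Propositional using (_∈_)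
open import Data.List.Membership.Propositional.Properties
  using (∈-map⁺; ∈-map⁻; ∈-filter⁺; ∈-filter⁻; ∈-applyUpTo⁺; foldr-selective)
import Data.List.Relation.Unary.Any as Any
open import Data.Product using (_,_; ∃₂; proj₂)
open import Data.Sum using (inj₁; inj₂; [_,_]′)
open import Function.Base using (_∘_)
open import Function.Bundles using (mk⇔; module Equivalence)
open import Relation.Binary.PropositionalEquality
  using (refl; sym; trans; cong; subst; subst₂; module ≡-Reasoning)
open import Relation.Nullary using (¬_; yes; no; contradiction)
open import Relation.Nullary.Decidable using (decidable-stable)
open import Relation.Unary using (Pred; Decidable)
import Data.Integer as ℤ
import Data.Integer.Properties as ℤP
import Data.Rational as ℚ
import Data.Rational.Properties as ℚP
import Data.Rational.Unnormalised as ℚᵘ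
import Data.Rational.Unnormalised.Properties as ℚᵘP

open Equivalence using (to; from)

stepwise-mono-≤ : (f : ℕ → ℕ) → (∀ m → f m ≤ f (suc m)) → ∀ {m n} → m ≤ n → f m ≤ f n
stepwise-mono-≤ f step m≤n = go (≤⇒≤′ m≤n)
  where
  go : ∀ {m n} → m ≤′ n → f m ≤ f n
  go ≤′-refl        = ≤-refl
  go (≤′-step m≤′n) = ≤-trans (go m≤′n) (step _)

1≤m*n⇒1≤m : ∀ m {n} → 1 ≤ m * n → 1 ≤ m
1≤m*n⇒1≤m (suc _) _ = s≤s z≤n

[2k+h]²≡4k[k+h]+h² : ∀ k h → (k + (k + h)) * (k + (k + h)) ≡ 4 * (k * (k + h)) + h * h
[2k+h]²≡4k[k+h]+h² = solve-∀

4mn≤[m+n]² : ∀ m n → 4 * (m * n) ≤ (m + n) * (m + n)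
4mn≤[m+n]² m n = [ ordered , (λ n≤m → subst₂ _≤_ (cong (4 *_) (*-comm n m)) (cong (λ x → x * x) (+-comm n m))
                                                 (ordered n≤m)) ]′
                   (≤-total m n)
  where
  ordered : ∀ {m n} → m ≤ n → 4 * (m * n) ≤ (m + n) * (m + n)
  ordered {m} m≤n with m≤n⇒∃[o]m+o≡n m≤n
  ... | h , refl = subst (4 * (m * (m + h)) ≤_) (sym ([2k+h]²≡4k[k+h]+h² m h)) (m≤m+n _ (h * h))

data EvenOdd : ℕ → Set where
  even : ∀ a → EvenOdd (a + a)
  odd  : ∀ a → EvenOdd (suc (a + a))

evenOdd : ∀ n → EvenOdd n
evenOdd zero    = even zero
evenOdd (suc n) with evenOdd n
... | even a = odd a
... | odd a  = subst EvenOdd (cong suc (+-suc a a)) (even (suc a))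

+a/b≤+c/d⇔a*d≤c*b : ∀ a b c d .{{_ : NonZero b}} .{{_ : NonZero d}} →
                    (ℤ.+ a ℚ./ b) ℚ.≤ (ℤ.+ c ℚ./ d) ⇔ a * d ≤ c * b
+a/b≤+c/d⇔a*d≤c*b a (suc b) c (suc d) = mk⇔
  (λ a/b≤c/d → unnormalised⇒ (ℚᵘP.≤-respʳ-≃ c≃ (ℚᵘP.≤-respˡ-≃ a≃ (ℚP.toℚᵘ-mono-≤ a/b≤c/d))))
  (λ ad≤cb → ℚP.toℚᵘ-cancel-≤ (ℚᵘP.≤-respʳ-≃ (ℚᵘP.≃-sym c≃) (ℚᵘP.≤-respˡ-≃ (ℚᵘP.≃-sym a≃) (unnormalised⇐ ad≤cb))))
  where
  a≃ : ℚ.toℚᵘ (ℤ.+ a ℚ./ suc b) ℚᵘ.≃ ℚᵘ.mkℚᵘ (ℤ.+ a) b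
  a≃ = ℚP.toℚᵘ-fromℚᵘ (ℚᵘ.mkℚᵘ (ℤ.+ a) b)
  c≃ : ℚ.toℚᵘ (ℤ.+ c ℚ./ suc d) ℚᵘ.≃ ℚᵘ.mkℚᵘ (ℤ.+ c) d
  c≃ = ℚP.toℚᵘ-fromℚᵘ (ℚᵘ.mkℚᵘ (ℤ.+ c) d)
  unnormalised⇒ : ℚᵘ.mkℚᵘ (ℤ.+ a) b ℚᵘ.≤ ℚᵘ.mkℚᵘ (ℤ.+ c) d → a * suc d ≤ c * suc b
  unnormalised⇒ (ℚᵘ.*≤* le) =
    ℤP.drop‿+≤+ (subst₂ ℤ._≤_ (sym (ℤP.pos-* a (suc d))) (sym (ℤP.pos-* c (suc b))) le)
  unnormalised⇐ : a * suc d ≤ c * suc b → ℚᵘ.mkℚᵘ (ℤ.+ a) b ℚᵘ.≤ ℚᵘ.mkℚᵘ (ℤ.+ c) d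
  unnormalised⇐ le = ℚᵘ.*≤* (subst₂ ℤ._≤_ (ℤP.pos-* a (suc d)) (ℤP.pos-* c (suc b)) (ℤ.+≤+ le))

F-≤⇔ : ∀ m n → F m ℚ.≤ F n ⇔ m * s n ≤ n * s m
F-≤⇔ m n = +a/b≤+c/d⇔a*d≤c*b m (s m) n (s n) {{s-nonZero m}} {{s-nonZero n}}

foldr-⊓-≤ : ∀ b {x xs} → x ∈ xs → foldr _⊓_ b xs ≤ x
foldr-⊓-≤ b {x} {xs} x∈xs = foldr-preservesᵒ {P = _≤ x}
  (λ y z → [ m≤n⇒m⊓o≤n z , m≤n⇒o⊓m≤n y ]′) b xs (inj₂ (Any.map (≤-reflexive ∘ sym) x∈xs))

s-*-≤ : ∀ {a b} → 1 ≤ a → 1 ≤ b → s (a * b) ≤ a + b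
s-*-≤ {suc a} {suc b} _ _ = begin
  s n                ≤⟨ foldr-⊓-≤ (suc n) (∈-map⁺ (λ i → suc i + n / suc i) {xs = divisorIdx n} a∈divisorIdx) ⟩
  suc a + n / suc a  ≡⟨ cong (suc a +_) n/[1+a]≡1+b ⟩
  suc a + suc b      ∎
  where
  open ≤-Reasoning
  n : ℕ
  n = suc a * suc b
  a∈divisorIdx : a ∈ divisorIdx n
  a∈divisorIdx = ∈-filter⁺ (λ i → suc i ∣? n) {xs = applyUpTo (λ i → i) n}
                   (∈-applyUpTo⁺ (λ i → i) (m≤m*n (suc a) (suc b))) (m∣m*n (suc b))
  n/[1+a]≡1+b : n / suc a ≡ suc b
  n/[1+a]≡1+b = trans (/-congˡ {o = suc a} (*-comm (suc a) (suc b))) (m*n/n≡m (suc b) (suc a))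

s-factorisation : ∀ n → ∃₂ λ a b → n ≡ a * b × s n ≡ a + b
s-factorisation n with foldr-selective ⊓-sel (suc n) (map (λ i → suc i + n / suc i) (divisorIdx n))
... | inj₁ s≡1+n = 1 , n , sym (*-identityˡ n) , s≡1+n
... | inj₂ s∈ with ∈-map⁻ (λ i → suc i + n / suc i) s∈
...   | i , i∈ , s≡ = suc i , n / suc i , sym (m*[n/m]≡n 1+i∣n) , s≡
  where
  1+i∣n : suc i ∣ n
  1+i∣n = proj₂ (∈-filter⁻ (λ j → suc j ∣? n) {xs = applyUpTo (λ j → j) n} i∈)

s-factorisation-k[k+h] : ∀ n → ∃₂ λ k h → n ≡ k * (k + h) × s n ≡ k + (k + h)
s-factorisation-k[k+h] n with s-factorisation n
... | a , b , n≡ab , s≡a+b with ≤-total a b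
...   | inj₁ a≤b = a , _ , subst (λ b → n ≡ a * b × s n ≡ a + b) (sym (m+[n∸m]≡n a≤b)) (n≡ab , s≡a+b)
...   | inj₂ b≤a = b , _ , subst (λ a → n ≡ b * a × s n ≡ b + a) (sym (m+[n∸m]≡n b≤a))
                             (trans n≡ab (*-comm a b) , trans s≡a+b (+-comm a b))

t-suc : ∀ h → t (suc h) ≡ h + t h
t-suc zero    = refl
t-suc (suc h) = begin
  suc (suc h) * suc h / 2      ≡⟨ /-congˡ (expand h) ⟩
  (suc h * h + suc h * 2) / 2  ≡⟨ +-distrib-/-∣ʳ (suc h * h) (divides-refl (suc h)) ⟩
  t (suc h) + suc h * 2 / 2    ≡⟨ cong (t (suc h) +_) (m*n/n≡m (suc h) 2) ⟩
  t (suc h) + suc h            ≡⟨ +-comm (t (suc h)) (suc h) ⟩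
  suc h + t (suc h)            ∎
  where
  open ≡-Reasoning
  expand : ∀ h → suc (suc h) * suc h ≡ suc h * h + suc h * 2
  expand = solve-∀

t-mono : ∀ {i j} → i ≤ j → t i ≤ t j
t-mono = stepwise-mono-≤ t (λ h → subst (t h ≤_) (sym (t-suc h)) (m≤n+m (t h) h))

h*h≡h+2*t : ∀ h → h * h ≡ h + 2 * t h
h*h≡h+2*t zero    = refl
h*h≡h+2*t (suc h) = begin
  suc h * suc h               ≡⟨ expand h ⟩
  h * h + suc (h + h)         ≡⟨ cong (_+ suc (h + h)) (h*h≡h+2*t h) ⟩
  h + 2 * t h + suc (h + h)   ≡⟨ regroup h (t h) ⟩
  suc h + 2 * (h + t h)       ≡⟨ cong (λ x → suc h + 2 * x) (t-suc h) ⟨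
  suc h + 2 * t (suc h)       ∎
  where
  open ≡-Reasoning
  expand : ∀ h → suc h * suc h ≡ h * h + suc (h + h)
  expand = solve-∀
  regroup : ∀ h x → h + 2 * x + suc (h + h) ≡ suc h + 2 * (h + x)
  regroup = solve-∀

h≤1+t : ∀ h → h ≤ suc (t h)
h≤1+t zero    = z≤n
h≤1+t (suc h) = s≤s (subst (h ≤_) (sym (t-suc h)) (m≤m+n h (t h)))

module DownClosedCount {p} {P : Pred ℕ p} (P? : Decidable P)
                       (P-down : ∀ {i j} → i ≤ j → P j → P i) where

  count : ℕ → ℕ
  count m = length (filter P? (applyUpTo suc m))

  count-suc : ∀ m → count (suc m) ≡ count m + length (filter P? [ suc m ])
  count-suc m = begin
    count (suc m)                                    ≡⟨ cong (length ∘ filter P?) (applyUpTo-∷ʳ suc m) ⟨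
    length (filter P? (applyUpTo suc m ++ [ suc m ])) ≡⟨ cong length (filter-++ P? (applyUpTo suc m) [ suc m ]) ⟩
    length (filter P? (applyUpTo suc m) ++ filter P? [ suc m ])
                                                     ≡⟨ length-++ (filter P? (applyUpTo suc m)) ⟩
    count m + length (filter P? [ suc m ])           ∎
    where open ≡-Reasoning

  count-accept : ∀ {m} → P (suc m) → count (suc m) ≡ suc (count m)
  count-accept {m} P[1+m] = trans (count-suc m)
    (trans (cong (λ xs → count m + length xs) (filter-accept P? P[1+m])) (+-comm (count m) 1))

  count-reject : ∀ {m} → ¬ P (suc m) → count (suc m) ≡ count m
  count-reject {m} ¬P[1+m] = trans (count-suc m)
    (trans (cong (λ xs → count m + length xs) (filter-reject P? ¬P[1+m])) (+-identityʳ (count m)))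

  count-≤ : ∀ m → count m ≤ m
  count-≤ m = subst (count m ≤_) (length-applyUpTo suc m) (length-filter P? (applyUpTo suc m))

  count-all : ∀ {m} → P m → count m ≡ m
  count-all {zero}  _      = refl
  count-all {suc m} P[1+m] = trans (count-accept P[1+m]) (cong suc (count-all (P-down (n≤1+n m) P[1+m])))

  count-mono : ∀ {m n} → m ≤ n → count m ≤ count n
  count-mono = stepwise-mono-≤ count (λ m → subst (count m ≤_) (sym (count-suc m)) (m≤m+n (count m) _))

  ≤-count : ∀ {h m} → P h → h ≤ m → h ≤ count m
  ≤-count {m = m} Ph h≤m = subst (_≤ count m) (count-all Ph) (count-mono h≤m)

  count-< : ∀ {h} m → 1 ≤ h → ¬ P h → count m < h
  count-< zero        1≤h _   = 1≤h
  count-< {h} (suc m) 1≤h ¬Ph with P? (suc m)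
  ... | yes P[1+m] = ≤-<-trans (count-≤ (suc m)) (≰⇒> (λ h≤1+m → ¬Ph (P-down h≤1+m P[1+m])))
  ... | no ¬P[1+m] = subst (_< h) (sym (count-reject ¬P[1+m])) (count-< m 1≤h ¬Ph)

≤T⇔t≤ : ∀ x h → h ≤ T x ⇔ t h ≤ x
≤T⇔t≤ x zero      = mk⇔ (λ _ → z≤n) (λ _ → z≤n)
≤T⇔t≤ x h@(suc _) = mk⇔
  (λ h≤T → decidable-stable (t h ≤? x) (λ th≰x → <⇒≱ (count-< (suc x) (s≤s z≤n) th≰x) h≤T))
  (λ th≤x → ≤-count th≤x (≤-trans (h≤1+t h) (s≤s th≤x)))
  where open DownClosedCount (λ j → t j ≤? x) (λ i≤j tj≤x → ≤-trans (t-mono i≤j) tj≤x)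

-- The inequality σ * σ ≤ 4 * n + σ, used throughout, is σ(σ - 1) ≤ 4n without truncated subtraction.
t≤k⇔[2k+h]²≤4k[k+h]+[2k+h] : ∀ k h →
  t h ≤ k ⇔ (k + (k + h)) * (k + (k + h)) ≤ 4 * (k * (k + h)) + (k + (k + h))
t≤k⇔[2k+h]²≤4k[k+h]+[2k+h] k h = mk⇔
  (λ th≤k → +-cancelʳ-≤ (2 * k) _ _ (begin
     σ * σ + 2 * k       ≡⟨ identity ⟩
     4n+σ + 2 * t h      ≤⟨ +-monoʳ-≤ 4n+σ (*-monoʳ-≤ 2 th≤k) ⟩
     4n+σ + 2 * k        ∎))
  (λ σ²≤4n+σ → *-cancelˡ-≤ 2 (+-cancelˡ-≤ 4n+σ _ _ (begin
     4n+σ + 2 * t h      ≡⟨ identity ⟨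
     σ * σ + 2 * k       ≤⟨ +-monoˡ-≤ (2 * k) σ²≤4n+σ ⟩
     4n+σ + 2 * k        ∎)))
  where
  open ≤-Reasoning
  σ 4n+σ : ℕ
  σ = k + (k + h)
  4n+σ = 4 * (k * (k + h)) + σ
  regroup : ∀ k h x → 4 * (k * (k + h)) + (h + 2 * x) + 2 * k ≡ 4 * (k * (k + h)) + (k + (k + h)) + 2 * x
  regroup = solve-∀
  identity : σ * σ + 2 * k ≡ 4n+σ + 2 * t h
  identity = begin-equality
    σ * σ + 2 * k                        ≡⟨ cong (_+ 2 * k) ([2k+h]²≡4k[k+h]+h² k h) ⟩
    4 * (k * (k + h)) + h * h + 2 * k    ≡⟨ cong (λ x → 4 * (k * (k + h)) + x + 2 * k) (h*h≡h+2*t h) ⟩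
    4 * (k * (k + h)) + (h + 2 * t h) + 2 * k ≡⟨ regroup k h (t h) ⟩
    4n+σ + 2 * t h                       ∎

[a*b]/[a+b]≤n/σ : ∀ {n σ} a b → σ * σ ≤ 4 * n + σ → a * b ≤ n → a * b * σ ≤ n * (a + b)
[a*b]/[a+b]≤n/σ {n} {σ} a b σ²≤4n+σ ab≤n = [ large , small ]′ (≤-<-connex σ τ)
  where
  open ≤-Reasoning
  τ : ℕ
  τ = a + b
  large : σ ≤ τ → a * b * σ ≤ n * τ
  large σ≤τ = *-mono-≤ ab≤n σ≤τ
  τσ≤4n : τ < σ → τ * σ ≤ 4 * n
  τσ≤4n τ<σ = +-cancelˡ-≤ σ _ _ (begin
    suc τ * σ  ≤⟨ *-monoˡ-≤ σ τ<σ ⟩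
    σ * σ      ≤⟨ σ²≤4n+σ ⟩
    4 * n + σ  ≡⟨ +-comm (4 * n) σ ⟩
    σ + 4 * n  ∎)
  rearrange : ∀ τ n → τ * (4 * n) ≡ 4 * (n * τ)
  rearrange = solve-∀
  small : τ < σ → a * b * σ ≤ n * τ
  small τ<σ = *-cancelˡ-≤ 4 (begin
    4 * (a * b * σ)   ≡⟨ *-assoc 4 (a * b) σ ⟨
    4 * (a * b) * σ   ≤⟨ *-monoˡ-≤ σ (4mn≤[m+n]² a b) ⟩
    τ * τ * σ         ≡⟨ *-assoc τ τ σ ⟩
    τ * (τ * σ)       ≤⟨ *-monoʳ-≤ τ (τσ≤4n τ<σ) ⟩
    τ * (4 * n)       ≡⟨ rearrange τ n ⟩
    4 * (n * τ)       ∎)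

σ²≤4n+σ⇒almostSquare : ∀ {n σ} → σ * σ ≤ 4 * n + σ → s n ≤ σ → AlmostSquare n
σ²≤4n+σ⇒almostSquare {n} {σ} σ²≤4n+σ sn≤σ m _ m≤n with s-factorisation-k[k+h] m
... | k , h , refl , sm≡2k+h = from (F-≤⇔ m n) (begin
  m * s n            ≤⟨ *-monoʳ-≤ m sn≤σ ⟩
  m * σ              ≤⟨ [a*b]/[a+b]≤n/σ k (k + h) σ²≤4n+σ m≤n ⟩
  n * (k + (k + h))  ≡⟨ cong (n *_) sm≡2k+h ⟨
  n * s m            ∎)
  where open ≤-Reasoning

-- Since s (c * d) ≤ c + d, a BetterProduct n σ is an m = c * d ≤ n with F m > n / σ.
BetterProduct : ℕ → ℕ → Set
BetterProduct n σ = ∃₂ λ c d → 1 ≤ c × 1 ≤ d × c * d ≤ n × n * (c + d) < c * d * σ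

betterProduct-mono : ∀ {n σ σ′} → σ ≤ σ′ → BetterProduct n σ → BetterProduct n σ′
betterProduct-mono σ≤σ′ (c , d , 1≤c , 1≤d , cd≤n , better) =
  c , d , 1≤c , 1≤d , cd≤n , <-≤-trans better (*-monoʳ-≤ (c * d) σ≤σ′)

[c+d][c+d+1]≤4n⇒cd≤n : ∀ {n} c d → (c + d) * suc (c + d) ≤ 4 * n → c * d ≤ n
[c+d][c+d+1]≤4n⇒cd≤n {n} c d bound = *-cancelˡ-≤ 4 (begin
  4 * (c * d)            ≤⟨ 4mn≤[m+n]² c d ⟩
  (c + d) * (c + d)      ≤⟨ *-monoʳ-≤ (c + d) (n≤1+n (c + d)) ⟩
  (c + d) * suc (c + d)  ≤⟨ bound ⟩
  4 * n                  ∎)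
  where open ≤-Reasoning

n[2a+1]<a[a+1][2a+2] : ∀ {n} a .{{_ : NonZero a}} → 4 * n < suc (a + a) * suc (suc (a + a)) →
                       n * (a + suc a) < a * suc a * suc (suc (a + a))
n[2a+1]<a[a+1][2a+2] {n} a upper = *-cancelˡ-< 2 _ _ (begin-strict
  2 * (n * (a + suc a))                ≡⟨ 2[n[2a+1]]≡2n[2a+1] n a ⟩
  2 * n * suc (a + a)                  ≤⟨ *-monoˡ-≤ (suc (a + a)) 2n≤Q ⟩
  Q * suc (a + a)                      <⟨ m<m+n _ (>-nonZero⁻¹ a) ⟩
  Q * suc (a + a) + a                  ≡⟨ Q[2a+1]+a≡2a[a+1][2a+2] a ⟩
  2 * (a * suc a * suc (suc (a + a)))  ∎)
  where
  open ≤-Reasoning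
  Q : ℕ
  Q = a + a + a * suc (a + a)
  [2a+1][2a+2]≡2[a+1][2a+1] : ∀ a → suc (a + a) * suc (suc (a + a)) ≡ 2 * (suc a * suc (a + a))
  [2a+1][2a+2]≡2[a+1][2a+1] = solve-∀
  2[n[2a+1]]≡2n[2a+1] : ∀ n a → 2 * (n * (a + suc a)) ≡ 2 * n * suc (a + a)
  2[n[2a+1]]≡2n[2a+1] = solve-∀
  Q[2a+1]+a≡2a[a+1][2a+2] : ∀ a → (a + a + a * suc (a + a)) * suc (a + a) + a ≡ 2 * (a * suc a * suc (suc (a + a)))
  Q[2a+1]+a≡2a[a+1][2a+2] = solve-∀
  2n≤Q : 2 * n ≤ Q
  2n≤Q = ≤-pred (*-cancelˡ-< 2 _ _ (subst₂ _<_ (*-assoc 2 2 n) ([2a+1][2a+2]≡2[a+1][2a+1] a) upper))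

n[2a+2]<[a+1]²[2a+3] : ∀ {n} a → 4 * n < suc (suc (a + a)) * suc (suc (suc (a + a))) →
                       n * (suc a + suc a) < suc a * suc a * suc (suc (suc (a + a)))
n[2a+2]<[a+1]²[2a+3] {n} a upper =
  subst₂ _<_ ([a+1][2n]≡n[2a+2] n a) (sym (*-assoc (suc a) (suc a) (suc (suc (suc (a + a)))))) (*-monoʳ-< (suc a) 2n<[a+1][2a+3])
  where
  [2a+2][2a+3]≡2[a+1][2a+3] : ∀ a →
    suc (suc (a + a)) * suc (suc (suc (a + a))) ≡ 2 * (suc a * suc (suc (suc (a + a))))
  [2a+2][2a+3]≡2[a+1][2a+3] = solve-∀
  [a+1][2n]≡n[2a+2] : ∀ n a → suc a * (2 * n) ≡ n * (suc a + suc a)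
  [a+1][2n]≡n[2a+2] = solve-∀
  2n<[a+1][2a+3] : 2 * n < suc a * suc (suc (suc (a + a)))
  2n<[a+1][2a+3] = *-cancelˡ-< 2 _ _ (subst₂ _<_ (*-assoc 2 2 n) ([2a+2][2a+3]≡2[a+1][2a+3] a) upper)

n[2a]<a²[2a+2] : ∀ {n} a .{{_ : NonZero a}} → n < a * suc a → n * (a + a) < a * a * suc (suc (a + a))
n[2a]<a²[2a+2] {n} a@(suc _) n<a[a+1] =
  subst (n * (a + a) <_) (a[a+1][2a]≡a²[2a+2] a) (*-monoˡ-< (a + a) n<a[a+1])
  where
  a[a+1][2a]≡a²[2a+2] : ∀ a → a * suc a * (a + a) ≡ a * a * suc (suc (a + a))
  a[a+1][2a]≡a²[2a+2] = solve-∀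

n[2a+1]<a[a+1][2a+3] : ∀ {n} a .{{_ : NonZero a}} → n < suc a * suc a →
                       n * (a + suc a) < a * suc a * suc (suc (suc (a + a)))
n[2a+1]<a[a+1][2a+3] {n} a n<[a+1]² = begin-strict
  n * (a + suc a)                      ≤⟨ *-monoˡ-≤ (a + suc a) (≤-pred n<[a+1]²) ⟩
  R * (a + suc a)                      <⟨ m<m+n _ (>-nonZero⁻¹ a) ⟩
  R * (a + suc a) + a                  ≡⟨ R[2a+1]+a≡a[a+1][2a+3] a ⟩
  a * suc a * suc (suc (suc (a + a)))  ∎
  where
  open ≤-Reasoning
  R : ℕ
  R = a + a * suc a
  R[2a+1]+a≡a[a+1][2a+3] : ∀ a → (a + a * suc a) * (a + suc a) + a ≡ a * suc a * suc (suc (suc (a + a)))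
  R[2a+1]+a≡a[a+1][2a+3] = solve-∀

-- The split of τ + 1 into c + d with |c - d| ≤ 1 if then cd ≤ n, and otherwise the split of τ.
betterProduct-base : ∀ {n} τ → 1 ≤ n → τ * suc τ ≤ 4 * n → 4 * n < suc τ * suc (suc τ) →
                     BetterProduct n (suc (suc τ))
betterProduct-base {n} τ 1≤n lower upper with evenOdd τ
... | even zero = contradiction (≤-trans (s≤s (s≤s z≤n)) (*-monoʳ-≤ 4 1≤n)) (<⇒≱ upper)
... | even a@(suc _) with a * suc a ≤? n
...   | yes fits = a , suc a , s≤s z≤n , s≤s z≤n , fits , n[2a+1]<a[a+1][2a+2] {n} a upper
...   | no ¬fits = a , a , s≤s z≤n , s≤s z≤n , [c+d][c+d+1]≤4n⇒cd≤n {n} a a lower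
                 , n[2a]<a²[2a+2] {n} a (≰⇒> ¬fits)
betterProduct-base {n} τ 1≤n lower upper | odd zero =
  1 , 1 , s≤s z≤n , s≤s z≤n , 1≤n , n[2a+2]<[a+1]²[2a+3] {n} 0 upper
betterProduct-base {n} τ 1≤n lower upper | odd a@(suc _) with suc a * suc a ≤? n
... | yes fits = suc a , suc a , s≤s z≤n , s≤s z≤n , fits , n[2a+2]<[a+1]²[2a+3] {n} a upper
... | no ¬fits = a , suc a , s≤s z≤n , s≤s z≤n
               , [c+d][c+d+1]≤4n⇒cd≤n {n} a (suc a) (subst (λ τ → τ * suc τ ≤ 4 * n) (sym (+-suc a a)) lower)
               , n[2a+1]<a[a+1][2a+3] {n} a (≰⇒> ¬fits)

betterProduct-threshold : ∀ {n} σ → 1 ≤ n → σ * σ ≤ 4 * n + σ → 4 * n + suc σ < suc σ * suc σ →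
                          BetterProduct n (suc σ)
betterProduct-threshold zero        _   _     upper = contradiction (m≤n+m 1 _) (<⇒≱ upper)
betterProduct-threshold {n} (suc τ) 1≤n lower upper = betterProduct-base {n} τ 1≤n
  (+-cancelˡ-≤ (suc τ) _ _ (subst (suc τ * suc τ ≤_) (+-comm (4 * n) (suc τ)) lower))
  (+-cancelˡ-< (suc (suc τ)) _ _ (subst (_< suc (suc τ) * suc (suc τ)) (+-comm (4 * n) (suc (suc τ))) upper))

betterProduct : ∀ {n} σ → 1 ≤ n → 4 * n + σ < σ * σ → BetterProduct n σ
betterProduct zero _ bound = contradiction bound n≮0
betterProduct {n} (suc σ) 1≤n bound with 4 * n + σ <? σ * σ
... | yes bound′ = betterProduct-mono (n≤1+n σ) (betterProduct {n} σ 1≤n bound′)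
... | no ¬bound′ = betterProduct-threshold {n} σ 1≤n (≮⇒≥ ¬bound′) bound

almostSquare⇒s²≤4n+s : ∀ {n} → 1 ≤ n → AlmostSquare n → s n * s n ≤ 4 * n + s n
almostSquare⇒s²≤4n+s {n} 1≤n almostSquare = decidable-stable (s n * s n ≤? 4 * n + s n) λ s²≰4n+s →
  let c , d , 1≤c , 1≤d , cd≤n , better = betterProduct (s n) 1≤n (≰⇒> s²≰4n+s) in
  <⇒≱ better (begin
    c * d * s n      ≤⟨ to (F-≤⇔ (c * d) n) (almostSquare (c * d) (*-mono-≤ 1≤c 1≤d) cd≤n) ⟩
    n * s (c * d)    ≤⟨ *-monoʳ-≤ n (s-*-≤ 1≤c 1≤d) ⟩
    n * (c + d)      ∎)
  where open ≤-Reasoning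

k[k+h]-almostSquare : ∀ {k h} → 1 ≤ k → t h ≤ k → AlmostSquare (k * (k + h))
k[k+h]-almostSquare {k} {h} 1≤k th≤k =
  σ²≤4n+σ⇒almostSquare (to (t≤k⇔[2k+h]²≤4k[k+h]+[2k+h] k h) th≤k) (s-*-≤ 1≤k (≤-trans 1≤k (m≤m+n k h)))

almostSquare⇒k[k+h] : ∀ {n} → 1 ≤ n → AlmostSquare n → ∃₂ λ k h → 1 ≤ k × t h ≤ k × n ≡ k * (k + h)
almostSquare⇒k[k+h] {n} 1≤n almostSquare with s-factorisation-k[k+h] n
... | k , h , refl , s≡2k+h =
  k , h , 1≤m*n⇒1≤m k 1≤n , from (t≤k⇔[2k+h]²≤4k[k+h]+[2k+h] k h) σ²≤4n+σ , refl
  where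
  σ²≤4n+σ : (k + (k + h)) * (k + (k + h)) ≤ 4 * n + (k + (k + h))
  σ²≤4n+σ = subst (λ σ → σ * σ ≤ 4 * n + σ) s≡2k+h (almostSquare⇒s²≤4n+s 1≤n almostSquare)

corollary1 : (n : ℕ) → 1 ≤ n →
    (AlmostSquare n ⇔ Σ ℕ (λ k → Σ ℕ (λ h → 1 ≤ k × h ≤ T k × n ≡ k * (k + h))))
corollary1 n 1≤n = mk⇔
  (λ almostSquare → let k , h , 1≤k , th≤k , n≡k[k+h] = almostSquare⇒k[k+h] 1≤n almostSquare
                    in k , h , 1≤k , from (≤T⇔t≤ k h) th≤k , n≡k[k+h])
  (λ (k , h , 1≤k , h≤Tk , n≡k[k+h]) →
     subst AlmostSquare (sym n≡k[k+h]) (k[k+h]-almostSquare 1≤k (to (≤T⇔t≤ k h) h≤Tk)))
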